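{- Let $k$ be a positive integer and let $\mathcal{H}$ be a $2$-complex in which every pair of vertices is connected by at least $k$ paths of length $2$ in the shadow graph. Suppose that $\mathcal{H}$ is homologically connected, but that for some triple of vertices $T$ the complex $\mathcal{H}+T$ has a bad $0$-$1$ function with support of size at most $k$. Then $\mathcal{H}+T$ contains a copy of $M$.
   Context: A $2$-complex consists of vertices, edges (pairs) and faces (triples), downward closed; its shadow graph is the graph formed by its vertices and edges. $\mathcal{H}+T$ is the complex obtained from $\mathcal{H}$ by adding $T$ as a face and, if necessary, all pairs in $T$ as edges. A complex is homologically connected if its zero-th and first homology groups over $\mathbb{F}_2$ vanish. A $0$-$1$ function on edges is bad if it takes value $1$ on an even number of edges of every face but is not induced by a $0$-$1$ vertex function $g$ (value $1$ exactly on edges $uv$ with $g(u)\ne g(v)$); its support is the set of edges with value $1$. A copy of $M$ is a face $abc$ such that the edges $ab$ and $ac$ lie in no other face and there is a path in the shadow graph between $a$ and $b$ not using the edges $ab$ or $ac$. -}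

module Defs where

open import Data.Bool using (Bool; true; false; _∧_; _∨_; not; _xor_; if_then_else_)
open import Data.Nat using (ℕ; _+_; _<ᵇ_)
open import Data.Fin using (Fin; toℕ; _≟_)
open import Data.List using (List; map; foldr; allFin)
open import Data.Nat.ListAction using (sum)
open import Data.Product using (Σ; _×_; ∃)
open import Data.Sum using (_⊎_)
open import Relation.Nullary using (¬_)
open import Relation.Nullary.Decidable using (⌊_⌋)
open import Relation.Binary.PropositionalEquality using (_≡_)
open import Relation.Binary.Construct.Closure.ReflexiveTransitive using (Star)

-- A (raw) 2-complex on the vertex set Fin n: edge and face indicator
-- functions on ordered pairs / triples (meant to be symmetric).
record Raw (n : ℕ) : Set where
  constructor mkRaw
  field
    E : Fin n → Fin n → Bool
    F : Fin n → Fin n → Fin n → Bool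
open Raw public

record IsComplex {n : ℕ} (H : Raw n) : Set where
  field
    E-irrefl : ∀ u → E H u u ≡ false
    E-sym    : ∀ u v → E H u v ≡ E H v u
    F-sym₁   : ∀ a b c → F H a b c ≡ F H b a c
    F-sym₂   : ∀ a b c → F H a b c ≡ F H a c b
    F-E      : ∀ a b c → F H a b c ≡ true → E H a b ≡ true

_==_ : ∀ {n} → Fin n → Fin n → Bool
u == v = ⌊ u ≟ v ⌋

addFace : ∀ {n} → Raw n → Fin n → Fin n → Fin n → Raw n
addFace {n} H a b c = mkRaw E' F'
  where
  inT : Fin n → Bool
  inT u = (u == a) ∨ ((u == b) ∨ (u == c))
  E' : Fin n → Fin n → Bool
  E' u v = E H u v ∨ (inT u ∧ (inT v ∧ not (u == v)))
  F' : Fin n → Fin n → Fin n → Bool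
  F' x y z = F H x y z ∨ (inT x ∧ (inT y ∧ (inT z ∧
               (not (x == y) ∧ (not (y == z) ∧ not (x == z))))))

parity : ∀ {n} → (Fin n → Bool) → Bool
parity {n} f = foldr _xor_ false (map f (allFin n))

count : ∀ {n} → (Fin n → Bool) → ℕ
count {n} f = sum (map (λ x → if f x then 1 else 0) (allFin n))

twoPaths : ∀ {n} → Raw n → Fin n → Fin n → ℕ
twoPaths H u v = count (λ w → E H u w ∧ E H w v)

IsEdgeChain : ∀ {n} → Raw n → (Fin n → Fin n → Bool) → Set
IsEdgeChain H c = (∀ u v → c u v ≡ c v u) × (∀ u v → c u v ≡ true → E H u v ≡ true)

IsFaceChain : ∀ {n} → Raw n → (Fin n → Fin n → Fin n → Bool) → Set
IsFaceChain H f = (∀ a b c → f a b c ≡ f b a c) × (∀ a b c → f a b c ≡ f a c b)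
                × (∀ a b c → f a b c ≡ true → F H a b c ≡ true)

∂₁ : ∀ {n} → (Fin n → Fin n → Bool) → Fin n → Bool
∂₁ c v = parity (λ u → c v u)

∂₂ : ∀ {n} → (Fin n → Fin n → Fin n → Bool) → Fin n → Fin n → Bool
∂₂ f u v = parity (λ w → f u v w)

H0vanishes : ∀ {n} → Raw n → Set
H0vanishes {n} H = ∀ (g : Fin n → Bool) → parity g ≡ false →
  ∃ λ c → IsEdgeChain H c × (∀ v → ∂₁ c v ≡ g v)

H1vanishes : ∀ {n} → Raw n → Set
H1vanishes {n} H = ∀ (c : Fin n → Fin n → Bool) → IsEdgeChain H c →
  (∀ v → ∂₁ c v ≡ false) →
  ∃ λ f → IsFaceChain H f × (∀ u v → ∂₂ f u v ≡ c u v)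

HomologicallyConnected : ∀ {n} → Raw n → Set
HomologicallyConnected H = H0vanishes H × H1vanishes H

-- A 0-1 function on edges, encoded as a symmetric function vanishing off edges.
-- Bad: even on every face, but not induced by a vertex function.
Bad : ∀ {n} → Raw n → (Fin n → Fin n → Bool) → Set
Bad {n} H φ = IsEdgeChain H φ
  × (∀ a b c → F H a b c ≡ true → (φ a b xor (φ b c xor φ a c)) ≡ false)
  × ¬ (∃ λ (g : Fin n → Bool) → ∀ u v → E H u v ≡ true → φ u v ≡ (g u xor g v))

supportSize : ∀ {n} → (Fin n → Fin n → Bool) → ℕ
supportSize {n} φ = sum (map (λ u → count (λ v → (toℕ u <ᵇ toℕ v) ∧ φ u v)) (allFin n))

sameEdge : ∀ {n} → Fin n → Fin n → Fin n → Fin n → Set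
sameEdge u v x y = (u ≡ x × v ≡ y) ⊎ (u ≡ y × v ≡ x)

AvoidStep : ∀ {n} → Raw n → Fin n → Fin n → Fin n → Fin n → Fin n → Set
AvoidStep H a b c u v = (E H u v ≡ true) × ¬ sameEdge u v a b × ¬ sameEdge u v a c

-- A copy of M: a face abc with ab, ac in no other face, and a path
-- from a to b in the shadow graph avoiding the edges ab and ac.
CopyOfM : ∀ {n} → Raw n → Set
CopyOfM {n} H = Σ (Fin n) λ a → Σ (Fin n) λ b → Σ (Fin n) λ c →
    (F H a b c ≡ true)
  × (∀ w → F H a b w ≡ true → w ≡ c)
  × (∀ w → F H a c w ≡ true → w ≡ b)
  × Star (AvoidStep H a b c) a b

-- Over F₂, H₁(H) = 0 makes every cocycle of H a coboundary. Pairing a cocycle φ with the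
-- boundary of a 2-chain gives 0, and any closed walk is a 1-cycle, hence a boundary, so φ
-- sums to 0 around every closed walk. Since any two vertices have a common neighbour
-- (k ≥ 1), every vertex v is reached by a walk from a root, and g(v) := the sum of φ along
-- it satisfies φ(uv) = g(u) + g(v) on every edge of H.
-- A bad function φ on H + T therefore agrees with δg on the edges of H. If two sides of T
-- were edges of H, the parity of φ on the face T would force φ = δg on the third side as
-- well, and φ would be induced. So T has two new sides ab, ac; they lie in no face but T,
-- and a common neighbour of a and b gives the path from a to b avoiding them.
module Submission where

open import Algebra using (CommutativeMonoid; CommutativeRing)
open import Data.Bool using (Bool; true; false; _∧_; _∨_; not; _xor_; if_then_else_)
open import Data.Bool.Properties
  using (T-≡; not-¬; ∧-assoc; ∧-comm; ∧-identityʳ; ∧-zeroʳ; ∨-zeroʳ; ∨-commutativeMonoid;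
         xor-assoc; xor-comm; xor-identityʳ; xor-same; ∧-distribˡ-xor; ∧-distribʳ-xor;
         xor-∧-commutativeRing)
open import Data.Empty using (⊥-elim)
open import Data.Fin using (Fin; zero; suc; toℕ; _≟_; _<_)
open import Data.Fin.Properties using (_<?_; <-cmp; <-trans)
open import Data.List using ([]; _∷_; map; foldr; tabulate; allFin)
open import Data.Nat using (ℕ; _≤_)
import Data.Nat.Properties as ℕ
open import Data.Nat.ListAction using (sum)
open import Data.Product as Product using (_×_; _,_; ∃; proj₁; proj₂)
open import Data.Sum as Sum using (_⊎_; inj₁; inj₂)
open import Function using (_∘_)
open import Function.Bundles using (Equivalence)
open import Relation.Binary using (tri<; tri≈; tri>)
open import Relation.Binary.Construct.Closure.ReflexiveTransitive as Star
  using (Star; ε; _◅_; _◅◅_; revApp; reverse)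
open import Relation.Binary.PropositionalEquality
open import Relation.Nullary using (¬_; yes; no; does)
open import Relation.Nullary.Decidable using (dec-true; dec-false; isYes≗does)

open import Algebra.Properties.CommutativeSemigroup
  (CommutativeRing.+-commutativeSemigroup xor-∧-commutativeRing)
  using (interchange; x∙yz≈y∙xz; x∙yz≈y∙zx)
import Algebra.Properties.CommutativeSemigroup
  (CommutativeMonoid.commutativeSemigroup ∨-commutativeMonoid) as ∨-Properties

open import Defs

∧≡true : ∀ a {b} → a ∧ b ≡ true → a ≡ true × b ≡ true
∧≡true true {true} _ = refl , refl

∨≡true : ∀ a {b} → a ∨ b ≡ true → a ≡ true ⊎ b ≡ true
∨≡true true  _  = inj₁ refl
∨≡true false eq = inj₂ eq

xor≡true : ∀ a {b} → a xor b ≡ true → a ≡ true ⊎ b ≡ true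
xor≡true true  _  = inj₁ refl
xor≡true false eq = inj₂ eq

xor≡false⇒≡ : ∀ a b → a xor b ≡ false → a ≡ b
xor≡false⇒≡ false false _ = refl
xor≡false⇒≡ false true  ()
xor≡false⇒≡ true  false ()
xor≡false⇒≡ true  true  _ = refl

xor-solve-middle : ∀ a x b → a xor (x xor b) ≡ false → x ≡ a xor b
xor-solve-middle a x b eq = xor≡false⇒≡ x (a xor b) (trans (x∙yz≈y∙xz x a b) eq)

xor-telescope : ∀ a b c → (a xor b) xor (b xor c) ≡ a xor c
xor-telescope a b c = begin
  (a xor b) xor (b xor c) ≡⟨ xor-assoc a b (b xor c) ⟩
  a xor (b xor (b xor c)) ≡⟨ cong (a xor_) (sym (xor-assoc b b c)) ⟩
  a xor ((b xor b) xor c) ≡⟨ cong (λ t → a xor (t xor c)) (xor-same b) ⟩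
  a xor c                 ∎
  where open ≡-Reasoning

∧-xor-not∧ : ∀ b p → (b ∧ p) xor (not b ∧ p) ≡ p
∧-xor-not∧ true  p = xor-identityʳ p
∧-xor-not∧ false p = refl

guarded-xor₃ : ∀ f o a b c → (f ≡ true → a xor (b xor c) ≡ false) →
  (f ∧ (o ∧ a)) xor ((f ∧ (o ∧ b)) xor (f ∧ (o ∧ c))) ≡ false
guarded-xor₃ false o     a b c _    = refl
guarded-xor₃ true  false a b c _    = refl
guarded-xor₃ true  true  a b c even = even refl

-- With p = [u<v], q = [v<w], s = [u<w], the three summands say that w comes last, first, or between.
split-by-third : ∀ p q s → (p ≡ true → q ≡ true → s ≡ true) → (p ≡ false → q ≡ false → s ≡ false) →
  p ≡ (p ∧ q) xor ((not s ∧ p) xor (s ∧ not q))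
split-by-third true  true  true  _ _ = refl
split-by-third true  true  false t _ with t refl refl
... | ()
split-by-third true  false true  _ _ = refl
split-by-third true  false false _ _ = refl
split-by-third false true  true  _ _ = refl
split-by-third false true  false _ _ = refl
split-by-third false false true  _ f with f refl refl
... | ()
split-by-third false false false _ _ = refl

even-rotate : ∀ x y z → x xor (y xor z) ≡ false → y xor (z xor x) ≡ false
even-rotate x y z even = trans (sym (x∙yz≈y∙zx x y z)) even

third-of-even : ∀ {x y z x′ y′ z′} → x xor (y xor z) ≡ false → x′ xor (y′ xor z′) ≡ false →
  y ≡ y′ → z ≡ z′ → x ≡ x′
third-of-even {x} {y} {z} {x′} {y′} {z′} even even′ y≡y′ z≡z′ =
  trans (xor≡false⇒≡ x (y xor z) even)
        (trans (cong₂ _xor_ y≡y′ z≡z′) (sym (xor≡false⇒≡ x′ (y′ xor z′) even′)))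

coboundary-even : ∀ p q r → (p xor q) xor ((q xor r) xor (p xor r)) ≡ false
coboundary-even p q r = begin
  (p xor q) xor ((q xor r) xor (p xor r)) ≡⟨ sym (xor-assoc (p xor q) (q xor r) (p xor r)) ⟩
  ((p xor q) xor (q xor r)) xor (p xor r) ≡⟨ cong (_xor (p xor r)) (xor-telescope p q r) ⟩
  (p xor r) xor (p xor r)                 ≡⟨ xor-same (p xor r) ⟩
  false                                   ∎
  where open ≡-Reasoning

==-refl : ∀ {n} (x : Fin n) → (x == x) ≡ true
==-refl x = trans (isYes≗does (x ≟ x)) (dec-true (x ≟ x) refl)

==-false : ∀ {n} {x y : Fin n} → x ≢ y → (x == y) ≡ false
==-false {x = x} {y} x≢y = trans (isYes≗does (x ≟ y)) (dec-false (x ≟ y) x≢y)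

==⇒≡ : ∀ {n} {x y : Fin n} → (x == y) ≡ true → x ≡ y
==⇒≡ {x = x} {y} eq with x ≟ y
... | yes x≡y = x≡y

not==⇒≢ : ∀ {n} {x y : Fin n} → not (x == y) ≡ true → x ≢ y
not==⇒≢ {x = x} eq refl = not-¬ eq (cong not (==-refl x))

suc==suc : ∀ {n} (u x : Fin n) → (suc u == suc x) ≡ (u == x)
suc==suc u x with u ≟ x
... | yes _ = refl
... | no _  = refl

_<ᵇ_ : ∀ {n} → Fin n → Fin n → Bool
u <ᵇ v = does (u <? v)

<ᵇ⇒< : ∀ {n} {u v : Fin n} → u <ᵇ v ≡ true → u < v
<ᵇ⇒< {u = u} {v} p = ℕ.<ᵇ⇒< (toℕ u) (toℕ v) (Equivalence.from T-≡ p)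

<ᵇ-trans : ∀ {n} {u v w : Fin n} → u <ᵇ v ≡ true → v <ᵇ w ≡ true → u <ᵇ w ≡ true
<ᵇ-trans {u = u} {v} {w} p q = dec-true (u <? w) (<-trans (<ᵇ⇒< {u = u} {v} p) (<ᵇ⇒< {u = v} {w} q))

<ᵇ-flip : ∀ {n} {u v : Fin n} → u ≢ v → v <ᵇ u ≡ not (u <ᵇ v)
<ᵇ-flip {u = u} {v} u≢v with <-cmp u v
... | tri< u<v _ v≮u = trans (dec-false (v <? u) v≮u) (cong not (sym (dec-true (u <? v) u<v)))
... | tri≈ _ u≡v _   = ⊥-elim (u≢v u≡v)
... | tri> u≮v _ v<u = trans (dec-true (v <? u) v<u) (cong not (sym (dec-false (u <? v) u≮v)))

ordered : ∀ {n} → Fin n → Fin n → Fin n → Bool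
ordered u v w = (u <ᵇ v) ∧ (v <ᵇ w)

<ᵇ-split-by-third : ∀ {n} {u v w : Fin n} → u ≢ v → v ≢ w → u ≢ w →
  u <ᵇ v ≡ ordered u v w xor (ordered w u v xor ordered u w v)
<ᵇ-split-by-third {u = u} {v} {w} u≢v v≢w u≢w
  rewrite <ᵇ-flip u≢w | <ᵇ-flip v≢w =
  split-by-third (u <ᵇ v) (v <ᵇ w) (u <ᵇ w) (<ᵇ-trans {u = u} {v} {w}) descending
  where
  ≮⇒>ᵇ : ∀ {x y} → x ≢ y → x <ᵇ y ≡ false → y <ᵇ x ≡ true
  ≮⇒>ᵇ x≢y x≮y = trans (<ᵇ-flip x≢y) (cong not x≮y)
  descending : u <ᵇ v ≡ false → v <ᵇ w ≡ false → u <ᵇ w ≡ false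
  descending u≮v v≮w = trans (<ᵇ-flip {u = w} {u} (u≢w ∘ sym))
    (cong not (<ᵇ-trans {u = w} {v} {u} (≮⇒>ᵇ v≢w v≮w) (≮⇒>ᵇ u≢v u≮v)))

⨁ : ∀ {n} → (Fin n → Bool) → Bool
⨁ {ℕ.zero}  f = false
⨁ {ℕ.suc n} f = f zero xor ⨁ (f ∘ suc)

foldr-xor-tabulate : ∀ {n} {A : Set} (f : A → Bool) (h : Fin n → A) →
  foldr _xor_ false (map f (tabulate h)) ≡ ⨁ (f ∘ h)
foldr-xor-tabulate {ℕ.zero}  f h = refl
foldr-xor-tabulate {ℕ.suc n} f h = cong (f (h zero) xor_) (foldr-xor-tabulate f (h ∘ suc))

parity≡⨁ : ∀ {n} (f : Fin n → Bool) → parity f ≡ ⨁ f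
parity≡⨁ f = foldr-xor-tabulate f (λ x → x)

⨁-cong : ∀ {n} {f g : Fin n → Bool} → (∀ x → f x ≡ g x) → ⨁ f ≡ ⨁ g
⨁-cong {ℕ.zero}  eq = refl
⨁-cong {ℕ.suc n} eq = cong₂ _xor_ (eq zero) (⨁-cong (eq ∘ suc))

⨁-false : ∀ {n} → ⨁ {n} (λ _ → false) ≡ false
⨁-false {ℕ.zero}  = refl
⨁-false {ℕ.suc n} = ⨁-false {n}

⨁-xor : ∀ {n} (f g : Fin n → Bool) → ⨁ (λ x → f x xor g x) ≡ ⨁ f xor ⨁ g
⨁-xor {ℕ.zero}  f g = refl
⨁-xor {ℕ.suc n} f g = trans (cong ((f zero xor g zero) xor_) (⨁-xor (f ∘ suc) (g ∘ suc)))
                             (interchange (f zero) (g zero) (⨁ (f ∘ suc)) (⨁ (g ∘ suc)))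

⨁-∧ˡ : ∀ {n} b (f : Fin n → Bool) → ⨁ (λ x → b ∧ f x) ≡ b ∧ ⨁ f
⨁-∧ˡ {ℕ.zero}  b f = sym (∧-zeroʳ b)
⨁-∧ˡ {ℕ.suc n} b f = trans (cong ((b ∧ f zero) xor_) (⨁-∧ˡ b (f ∘ suc)))
                           (sym (∧-distribˡ-xor b (f zero) (⨁ (f ∘ suc))))

⨁-∧ʳ : ∀ {n} b (f : Fin n → Bool) → ⨁ (λ x → f x ∧ b) ≡ ⨁ f ∧ b
⨁-∧ʳ {ℕ.zero}  b f = refl
⨁-∧ʳ {ℕ.suc n} b f = trans (cong ((f zero ∧ b) xor_) (⨁-∧ʳ b (f ∘ suc)))
                           (sym (∧-distribʳ-xor b (f zero) (⨁ (f ∘ suc))))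

⨁-comm : ∀ {m n} (h : Fin m → Fin n → Bool) → ⨁ (λ u → ⨁ (h u)) ≡ ⨁ (λ v → ⨁ (λ u → h u v))
⨁-comm {ℕ.zero}  {n} h = sym (⨁-false {n})
⨁-comm {ℕ.suc m} {n} h = trans (cong (⨁ (h zero) xor_) (⨁-comm (h ∘ suc)))
                               (sym (⨁-xor (h zero) (λ v → ⨁ (λ u → h (suc u) v))))

⨁-point : ∀ {n} (x : Fin n) (h : Fin n → Bool) → ⨁ (λ u → (u == x) ∧ h u) ≡ h x
⨁-point {ℕ.suc n} zero    h = trans (cong (h zero xor_) (⨁-false {n})) (xor-identityʳ (h zero))
⨁-point {ℕ.suc n} (suc x) h = trans (⨁-cong {n} (λ u → cong (_∧ h (suc u)) (suc==suc u x)))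
                                    (⨁-point x (h ∘ suc))

⨁-indicator : ∀ {n} (y : Fin n) → ⨁ (λ u → u == y) ≡ true
⨁-indicator y = trans (⨁-cong λ u → sym (∧-identityʳ (u == y))) (⨁-point y (λ _ → true))

⨁³ : ∀ {n} → (Fin n → Fin n → Fin n → Bool) → Bool
⨁³ h = ⨁ λ u → ⨁ λ v → ⨁ λ w → h u v w

⨁³-cong : ∀ {n} {h k : Fin n → Fin n → Fin n → Bool} → (∀ u v w → h u v w ≡ k u v w) → ⨁³ h ≡ ⨁³ k
⨁³-cong eq = ⨁-cong λ u → ⨁-cong λ v → ⨁-cong λ w → eq u v w

⨁³-false : ∀ {n} → ⨁³ {n} (λ _ _ _ → false) ≡ false
⨁³-false {n} = trans (⨁-cong {n} λ _ → trans (⨁-cong {n} λ _ → ⨁-false {n}) (⨁-false {n})) (⨁-false {n})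

⨁³-xor : ∀ {n} (h k : Fin n → Fin n → Fin n → Bool) →
  ⨁³ (λ u v w → h u v w xor k u v w) ≡ ⨁³ h xor ⨁³ k
⨁³-xor h k = trans (⨁-cong λ u → trans (⨁-cong λ v → ⨁-xor (h u v) (k u v))
                                       (⨁-xor (λ v → ⨁ (h u v)) (λ v → ⨁ (k u v))))
                   (⨁-xor (λ u → ⨁ λ v → ⨁ (h u v)) (λ u → ⨁ λ v → ⨁ (k u v)))

⨁³-xor₃ : ∀ {n} (h k l : Fin n → Fin n → Fin n → Bool) →
  ⨁³ (λ u v w → h u v w xor (k u v w xor l u v w)) ≡ ⨁³ h xor (⨁³ k xor ⨁³ l)
⨁³-xor₃ h k l = trans (⨁³-xor h (λ u v w → k u v w xor l u v w)) (cong (⨁³ h xor_) (⨁³-xor k l))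

⨁³-swap₂₃ : ∀ {n} (h : Fin n → Fin n → Fin n → Bool) → ⨁³ (λ u v w → h u w v) ≡ ⨁³ h
⨁³-swap₂₃ h = ⨁-cong λ u → ⨁-comm (λ v w → h u w v)

⨁³-rotate : ∀ {n} (h : Fin n → Fin n → Fin n → Bool) → ⨁³ (λ u v w → h v w u) ≡ ⨁³ h
⨁³-rotate h = trans (⨁-comm (λ u v → ⨁ (λ w → h v w u)))
                    (⨁-cong λ v → ⨁-comm (λ u w → h v w u))

Chain : ℕ → Set
Chain n = Fin n → Fin n → Bool

-- Each unordered pair {u,v} is counted once, through its orientation u < v.
⟪_∣_⟫ : ∀ {n} → Chain n → Chain n → Bool
⟪ φ ∣ c ⟫ = ⨁ λ u → ⨁ λ v → c u v ∧ (u <ᵇ v ∧ φ u v)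

⟪⟫-cong : ∀ {n} (φ : Chain n) {c d : Chain n} → (∀ u v → c u v ≡ d u v) → ⟪ φ ∣ c ⟫ ≡ ⟪ φ ∣ d ⟫
⟪⟫-cong φ eq = ⨁-cong λ u → ⨁-cong λ v → cong (_∧ (u <ᵇ v ∧ φ u v)) (eq u v)

⟪⟫-zero : ∀ {n} (φ : Chain n) → ⟪ φ ∣ (λ _ _ → false) ⟫ ≡ false
⟪⟫-zero {n} φ = trans (⨁-cong {n} λ _ → ⨁-false {n}) (⨁-false {n})

⟪⟫-xor : ∀ {n} (φ c d : Chain n) → ⟪ φ ∣ (λ u v → c u v xor d u v) ⟫ ≡ ⟪ φ ∣ c ⟫ xor ⟪ φ ∣ d ⟫
⟪⟫-xor φ c d =
  trans (⨁-cong λ u → trans (⨁-cong λ v → ∧-distribʳ-xor (K u v) (c u v) (d u v))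
                            (⨁-xor (λ v → c u v ∧ K u v) (λ v → d u v ∧ K u v)))
        (⨁-xor (λ u → ⨁ λ v → c u v ∧ K u v) (λ u → ⨁ λ v → d u v ∧ K u v))
  where
  K : Chain _
  K u v = u <ᵇ v ∧ φ u v

⟪⟫-point : ∀ {n} (φ : Chain n) (x y : Fin n) → ⟪ φ ∣ (λ u v → (u == x) ∧ (v == y)) ⟫ ≡ (x <ᵇ y ∧ φ x y)
⟪⟫-point φ x y = trans (⨁-cong λ u → trans (⨁-cong λ v → ∧-assoc (u == x) (v == y) (K u v))
                                          (trans (⨁-∧ˡ (u == x) (λ v → (v == y) ∧ K u v))
                                                 (cong ((u == x) ∧_) (⨁-point y (K u)))))
                       (⨁-point x (λ u → K u y))
  where
  K : Chain _
  K u v = u <ᵇ v ∧ φ u v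

edgeChain : ∀ {n} → Fin n → Fin n → Chain n
edgeChain x y u v = ((u == x) ∧ (v == y)) xor ((u == y) ∧ (v == x))

edgeChain-sym : ∀ {n} (x y u v : Fin n) → edgeChain x y u v ≡ edgeChain x y v u
edgeChain-sym x y u v =
  trans (xor-comm ((u == x) ∧ (v == y)) ((u == y) ∧ (v == x)))
        (cong₂ _xor_ (∧-comm (u == y) (v == x)) (∧-comm (u == x) (v == y)))

edgeChain-support : ∀ {n} {x y u v : Fin n} → edgeChain x y u v ≡ true → sameEdge u v x y
edgeChain-support {x = x} {y} {u} {v} eq =
  Sum.map ==∧==⇒≡×≡ ==∧==⇒≡×≡ (xor≡true ((u == x) ∧ (v == y)) eq)
  where
  ==∧==⇒≡×≡ : ∀ {a b c d : Fin _} → ((a == b) ∧ (c == d)) ≡ true → a ≡ b × c ≡ d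
  ==∧==⇒≡×≡ {a} {b} eq′ = Product.map ==⇒≡ ==⇒≡ (∧≡true (a == b) eq′)

∂₁-edgeChain : ∀ {n} (x y v : Fin n) → ∂₁ (edgeChain x y) v ≡ (v == x) xor (v == y)
∂₁-edgeChain x y v = begin
  ∂₁ (edgeChain x y) v
    ≡⟨ parity≡⨁ (edgeChain x y v) ⟩
  ⨁ (λ u → ((v == x) ∧ (u == y)) xor ((v == y) ∧ (u == x)))
    ≡⟨ ⨁-xor (λ u → (v == x) ∧ (u == y)) (λ u → (v == y) ∧ (u == x)) ⟩
  ⨁ (λ u → (v == x) ∧ (u == y)) xor ⨁ (λ u → (v == y) ∧ (u == x))
    ≡⟨ cong₂ _xor_ (⨁-∧ˡ (v == x) (_== y)) (⨁-∧ˡ (v == y) (_== x)) ⟩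
  ((v == x) ∧ ⨁ (_== y)) xor ((v == y) ∧ ⨁ (_== x))
    ≡⟨ cong₂ (λ s t → ((v == x) ∧ s) xor ((v == y) ∧ t)) (⨁-indicator y) (⨁-indicator x) ⟩
  ((v == x) ∧ true) xor ((v == y) ∧ true)
    ≡⟨ cong₂ _xor_ (∧-identityʳ (v == x)) (∧-identityʳ (v == y)) ⟩
  (v == x) xor (v == y) ∎
  where open ≡-Reasoning

⟪⟫-edgeChain : ∀ {n} (φ : Chain n) → (∀ u v → φ u v ≡ φ v u) → ∀ {x y} → x ≢ y →
  ⟪ φ ∣ edgeChain x y ⟫ ≡ φ x y
⟪⟫-edgeChain φ φ-sym {x} {y} x≢y = begin
  ⟪ φ ∣ edgeChain x y ⟫
    ≡⟨ ⟪⟫-xor φ (λ u v → (u == x) ∧ (v == y)) (λ u v → (u == y) ∧ (v == x)) ⟩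
  ⟪ φ ∣ (λ u v → (u == x) ∧ (v == y)) ⟫ xor ⟪ φ ∣ (λ u v → (u == y) ∧ (v == x)) ⟫
    ≡⟨ cong₂ _xor_ (⟪⟫-point φ x y) (⟪⟫-point φ y x) ⟩
  (x <ᵇ y ∧ φ x y) xor (y <ᵇ x ∧ φ y x)
    ≡⟨ cong₂ (λ s t → (x <ᵇ y ∧ φ x y) xor (s ∧ t)) (<ᵇ-flip x≢y) (φ-sym y x) ⟩
  (x <ᵇ y ∧ φ x y) xor (not (x <ᵇ y) ∧ φ x y)
    ≡⟨ ∧-xor-not∧ (x <ᵇ y) (φ x y) ⟩
  φ x y ∎
  where open ≡-Reasoning

module _ {n} {R : Fin n → Fin n → Set} where

  walkChain : ∀ {x y} → Star R x y → Chain n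
  walkChain ε                   u v = false
  walkChain (_◅_ {x} {y} _ w) u v = edgeChain x y u v xor walkChain w u v

  walkSum : Chain n → ∀ {x y} → Star R x y → Bool
  walkSum φ ε                   = false
  walkSum φ (_◅_ {x} {y} _ w) = φ x y xor walkSum φ w

  walkSum-◅◅ : ∀ φ {x y z} (w : Star R x y) (w′ : Star R y z) →
    walkSum φ (w ◅◅ w′) ≡ walkSum φ w xor walkSum φ w′
  walkSum-◅◅ φ ε                 w′ = refl
  walkSum-◅◅ φ (_◅_ {x} {y} _ w) w′ =
    trans (cong (φ x y xor_) (walkSum-◅◅ φ w w′)) (sym (xor-assoc (φ x y) (walkSum φ w) (walkSum φ w′)))

  walkSum-revApp : ∀ φ → (∀ u v → φ u v ≡ φ v u) → (R-sym : ∀ {u v} → R u v → R v u) →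
    ∀ {x y z} (w : Star R y x) (acc : Star R y z) →
    walkSum φ (revApp R-sym w acc) ≡ walkSum φ w xor walkSum φ acc
  walkSum-revApp φ φ-sym R-sym ε                 acc = refl
  walkSum-revApp φ φ-sym R-sym (_◅_ {x} {y} e w) acc = begin
    walkSum φ (revApp R-sym w (R-sym e ◅ acc))
      ≡⟨ walkSum-revApp φ φ-sym R-sym w (R-sym e ◅ acc) ⟩
    walkSum φ w xor (φ y x xor walkSum φ acc)
      ≡⟨ cong (λ t → walkSum φ w xor (t xor walkSum φ acc)) (φ-sym y x) ⟩
    walkSum φ w xor (φ x y xor walkSum φ acc)
      ≡⟨ sym (xor-assoc (walkSum φ w) (φ x y) (walkSum φ acc)) ⟩
    (walkSum φ w xor φ x y) xor walkSum φ acc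
      ≡⟨ cong (_xor walkSum φ acc) (xor-comm (walkSum φ w) (φ x y)) ⟩
    (φ x y xor walkSum φ w) xor walkSum φ acc ∎
    where open ≡-Reasoning

  walkSum-reverse : ∀ φ → (∀ u v → φ u v ≡ φ v u) → (R-sym : ∀ {u v} → R u v → R v u) →
    ∀ {x y} (w : Star R x y) → walkSum φ (reverse R-sym w) ≡ walkSum φ w
  walkSum-reverse φ φ-sym R-sym w = trans (walkSum-revApp φ φ-sym R-sym w ε) (xor-identityʳ (walkSum φ w))

  ∂₁-walkChain : ∀ {x y} (w : Star R x y) v → ∂₁ (walkChain w) v ≡ (v == x) xor (v == y)
  ∂₁-walkChain {x} ε v = trans (parity≡⨁ {n} (λ _ → false)) (trans (⨁-false {n}) (sym (xor-same (v == x))))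
  ∂₁-walkChain (_◅_ {x} {y} {z} e w) v = begin
    ∂₁ (walkChain (e ◅ w)) v
      ≡⟨ parity≡⨁ (walkChain (e ◅ w) v) ⟩
    ⨁ (λ u → edgeChain x y v u xor walkChain w v u)
      ≡⟨ ⨁-xor (edgeChain x y v) (walkChain w v) ⟩
    ⨁ (edgeChain x y v) xor ⨁ (walkChain w v)
      ≡⟨ sym (cong₂ _xor_ (parity≡⨁ (edgeChain x y v)) (parity≡⨁ (walkChain w v))) ⟩
    ∂₁ (edgeChain x y) v xor ∂₁ (walkChain w) v
      ≡⟨ cong₂ _xor_ (∂₁-edgeChain x y v) (∂₁-walkChain w v) ⟩
    ((v == x) xor (v == y)) xor ((v == y) xor (v == z))
      ≡⟨ xor-telescope (v == x) (v == y) (v == z) ⟩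
    (v == x) xor (v == z) ∎
    where open ≡-Reasoning

EvenOnFaces : ∀ {n} → Raw n → Chain n → Set
EvenOnFaces H φ = ∀ a b c → F H a b c ≡ true → (φ a b xor (φ b c xor φ a c)) ≡ false

IsCocycle : ∀ {n} → Raw n → Chain n → Set
IsCocycle H φ = IsEdgeChain H φ × EvenOnFaces H φ

Induced : ∀ {n} → Raw n → Chain n → Set
Induced {n} H φ = ∃ λ (g : Fin n → Bool) → ∀ u v → E H u v ≡ true → φ u v ≡ (g u xor g v)

restrict : ∀ {n} → Raw n → Chain n → Chain n
restrict H φ u v = φ u v ∧ E H u v

Adjacent : ∀ {n} → Raw n → Fin n → Fin n → Set
Adjacent H u v = E H u v ≡ true

Walk : ∀ {n} → Raw n → Fin n → Fin n → Set
Walk H = Star (Adjacent H)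

module _ {n} {H : Raw n} (isC : IsComplex H) where
  open IsComplex isC

  adjacent-sym : ∀ {u v} → Adjacent H u v → Adjacent H v u
  adjacent-sym {u} {v} uv = trans (E-sym v u) uv

  adjacent⇒≢ : ∀ {u v} → Adjacent H u v → u ≢ v
  adjacent⇒≢ {u} uu refl = not-¬ uu (E-irrefl u)

  face-rotate : ∀ {x y z} → F H x y z ≡ true → F H y z x ≡ true
  face-rotate {x} {y} {z} xyz = trans (sym (trans (F-sym₁ x y z) (F-sym₂ y x z))) xyz

  face-swap₂₃ : ∀ {x y z} → F H x y z ≡ true → F H x z y ≡ true
  face-swap₂₃ {x} {y} {z} xyz = trans (sym (F-sym₂ x y z)) xyz

  face⇒distinct : ∀ {u v w} → F H u v w ≡ true → u ≢ v × v ≢ w × u ≢ w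
  face⇒distinct {u} {v} {w} uvw =
      adjacent⇒≢ (F-E u v w uvw)
    , adjacent⇒≢ (F-E v w u (face-rotate uvw))
    , adjacent⇒≢ (F-E u w v (face-swap₂₃ uvw))

  walkChain-isEdgeChain : ∀ {x y} (w : Walk H x y) → IsEdgeChain H (walkChain w)
  walkChain-isEdgeChain w = symmetric w , support w
    where
    symmetric : ∀ {x y} (w : Walk H x y) u v → walkChain w u v ≡ walkChain w v u
    symmetric ε                 u v = refl
    symmetric (_◅_ {x} {y} _ w) u v = cong₂ _xor_ (edgeChain-sym x y u v) (symmetric w u v)
    support : ∀ {x y} (w : Walk H x y) u v → walkChain w u v ≡ true → E H u v ≡ true
    support (_◅_ {x} {y} xy w) u v eq with xor≡true (edgeChain x y u v) eq
    ... | inj₂ in-w = support w u v in-w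
    ... | inj₁ in-xy with edgeChain-support {x = x} {y} {u} {v} in-xy
    ...   | inj₁ (refl , refl) = xy
    ...   | inj₂ (refl , refl) = adjacent-sym xy

  ⟪⟫-walkChain : ∀ φ → (∀ u v → φ u v ≡ φ v u) → ∀ {x y} (w : Walk H x y) → ⟪ φ ∣ walkChain w ⟫ ≡ walkSum φ w
  ⟪⟫-walkChain φ φ-sym ε                  = ⟪⟫-zero φ
  ⟪⟫-walkChain φ φ-sym (_◅_ {x} {y} xy w) =
    trans (⟪⟫-xor φ (edgeChain x y) (walkChain w))
          (cong₂ _xor_ (⟪⟫-edgeChain φ φ-sym (adjacent⇒≢ xy)) (⟪⟫-walkChain φ φ-sym w))

  -- ⟨φ, ∂f⟩ = ⟨δφ, f⟩: each face u < v < w of f is met once through each of its three edges.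
  ⟪⟫-∂₂ : ∀ {φ f} → EvenOnFaces H φ → IsFaceChain H f → ⟪ φ ∣ ∂₂ f ⟫ ≡ false
  ⟪⟫-∂₂ {φ} {f} φ-even (f-sym₁₂ , f-sym₂₃ , f-support) = begin
    ⟪ φ ∣ ∂₂ f ⟫                              ≡⟨ ⨁-cong (λ u → ⨁-cong λ v → expand u v) ⟩
    ⨁³ (λ u v w → f u v w ∧ (u <ᵇ v ∧ φ u v)) ≡⟨ ⨁³-cong split ⟩
    ⨁³ (λ u v w → last u v w xor (first u v w xor middle u v w))
                                              ≡⟨ ⨁³-xor₃ last first middle ⟩
    ⨁³ last xor (⨁³ first xor ⨁³ middle)      ≡⟨ cong₂ (λ s t → ⨁³ last xor (s xor t)) relabel-first relabel-middle ⟩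
    ⨁³ last xor (⨁³ first′ xor ⨁³ middle′)    ≡⟨ sym (⨁³-xor₃ last first′ middle′) ⟩
    ⨁³ (λ u v w → last u v w xor (first′ u v w xor middle′ u v w))
                                              ≡⟨ ⨁³-cong even ⟩
    ⨁³ {n} (λ _ _ _ → false)                  ≡⟨ ⨁³-false {n} ⟩
    false                                     ∎
    where
    open ≡-Reasoning
    last first middle first′ middle′ : Fin n → Fin n → Fin n → Bool
    last    u v w = f u v w ∧ (ordered u v w ∧ φ u v)
    first   u v w = f u v w ∧ (ordered w u v ∧ φ u v)
    middle  u v w = f u v w ∧ (ordered u w v ∧ φ u v)
    first′  u v w = f u v w ∧ (ordered u v w ∧ φ v w)
    middle′ u v w = f u v w ∧ (ordered u v w ∧ φ u w)

    f-rotate : ∀ u v w → f v w u ≡ f u v w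
    f-rotate u v w = trans (f-sym₁₂ v w u) (trans (f-sym₂₃ w v u) (sym (trans (f-sym₂₃ u v w) (f-sym₁₂ u w v))))

    expand : ∀ u v → ∂₂ f u v ∧ (u <ᵇ v ∧ φ u v) ≡ ⨁ (λ w → f u v w ∧ (u <ᵇ v ∧ φ u v))
    expand u v = trans (cong (_∧ (u <ᵇ v ∧ φ u v)) (parity≡⨁ (f u v))) (sym (⨁-∧ʳ (u <ᵇ v ∧ φ u v) (f u v)))

    split : ∀ u v w → f u v w ∧ (u <ᵇ v ∧ φ u v) ≡ last u v w xor (first u v w xor middle u v w)
    split u v w with f u v w in uvw
    ... | false = refl
    ... | true  with face⇒distinct (f-support u v w uvw)
    ...   | u≢v , v≢w , u≢w =
      trans (cong (_∧ φ u v) (<ᵇ-split-by-third u≢v v≢w u≢w))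
            (trans (∧-distribʳ-xor (φ u v) (ordered u v w) _)
                   (cong ((ordered u v w ∧ φ u v) xor_) (∧-distribʳ-xor (φ u v) (ordered w u v) (ordered u w v))))

    relabel-first : ⨁³ first ≡ ⨁³ first′
    relabel-first = trans (sym (⨁³-rotate first))
      (⨁³-cong λ u v w → cong (_∧ (ordered u v w ∧ φ v w)) (f-rotate u v w))

    relabel-middle : ⨁³ middle ≡ ⨁³ middle′
    relabel-middle = trans (sym (⨁³-swap₂₃ middle))
      (⨁³-cong λ u v w → cong (_∧ (ordered u v w ∧ φ u w)) (sym (f-sym₂₃ u v w)))

    even : ∀ u v w → last u v w xor (first′ u v w xor middle′ u v w) ≡ false
    even u v w = guarded-xor₃ (f u v w) (ordered u v w) (φ u v) (φ v w) (φ u w) (φ-even u v w ∘ f-support u v w)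

  closedWalk-sum : H1vanishes H → ∀ {φ} → IsCocycle H φ → ∀ {x} (w : Walk H x x) → walkSum φ w ≡ false
  closedWalk-sum h1 {φ} ((φ-sym , _) , φ-even) {x} w = bounding (h1 (walkChain w) (walkChain-isEdgeChain w) cycle)
    where
    cycle : ∀ v → ∂₁ (walkChain w) v ≡ false
    cycle v = trans (∂₁-walkChain w v) (xor-same (v == x))
    bounding : (∃ λ f → IsFaceChain H f × (∀ u v → ∂₂ f u v ≡ walkChain w u v)) → walkSum φ w ≡ false
    bounding (f , f-face , ∂f≡w) = begin
      walkSum φ w          ≡⟨ sym (⟪⟫-walkChain φ φ-sym w) ⟩
      ⟪ φ ∣ walkChain w ⟫  ≡⟨ ⟪⟫-cong φ (λ u v → sym (∂f≡w u v)) ⟩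
      ⟪ φ ∣ ∂₂ f ⟫         ≡⟨ ⟪⟫-∂₂ φ-even f-face ⟩
      false                ∎
      where open ≡-Reasoning

  cocycle⇒induced : H1vanishes H → ∀ {φ} → IsCocycle H φ → ∀ r → (∀ v → Walk H r v) → Induced H φ
  cocycle⇒induced h1 {φ} φ-cocycle@((φ-sym , _) , _) r path = g , induced
    where
    g : Fin n → Bool
    g v = walkSum φ (path v)
    induced : ∀ u v → E H u v ≡ true → φ u v ≡ (g u xor g v)
    induced u v uv = xor-solve-middle (g u) (φ u v) (g v) (begin
      g u xor (φ u v xor g v)
        ≡⟨ cong (λ t → g u xor (φ u v xor t)) (sym (walkSum-reverse φ φ-sym adjacent-sym (path v))) ⟩
      walkSum φ (path u) xor walkSum φ (uv ◅ reverse adjacent-sym (path v))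
        ≡⟨ sym (walkSum-◅◅ φ (path u) (uv ◅ reverse adjacent-sym (path v))) ⟩
      walkSum φ (path u ◅◅ uv ◅ reverse adjacent-sym (path v))
        ≡⟨ closedWalk-sum h1 φ-cocycle (path u ◅◅ uv ◅ reverse adjacent-sym (path v)) ⟩
      false ∎)
      where open ≡-Reasoning

  restrict-on-edge : ∀ {φ u v} → E H u v ≡ true → restrict H φ u v ≡ φ u v
  restrict-on-edge {φ} {u} {v} uv = trans (cong (φ u v ∧_) uv) (∧-identityʳ (φ u v))

  restrict-isCocycle : ∀ {φ} → (∀ u v → φ u v ≡ φ v u) → EvenOnFaces H φ → IsCocycle H (restrict H φ)
  restrict-isCocycle {φ} φ-sym φ-even =
    ((λ u v → cong₂ _∧_ (φ-sym u v) (E-sym u v)) , (λ u v → proj₂ ∘ ∧≡true (φ u v)))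
    , λ x y z xyz → trans (cong₂ _xor_ (restrict-on-edge {φ} (F-E x y z xyz))
                                       (cong₂ _xor_ (restrict-on-edge {φ} (F-E y z x (face-rotate xyz)))
                                                    (restrict-on-edge {φ} (F-E x z y (face-swap₂₃ xyz)))))
                          (φ-even x y z xyz)

  walks-of-diameter-two : (∀ u v → u ≢ v → ∃ λ w → E H u w ≡ true × E H w v ≡ true) → ∀ r v → Walk H r v
  walks-of-diameter-two common r v with v ≟ r
  ... | yes refl = ε
  ... | no v≢r with common r v (v≢r ∘ sym)
  ...   | w , rw , wv = rw ◅ wv ◅ ε

InTriple : ∀ {n} → Fin n → Fin n → Fin n → Fin n → Set
InTriple a b c u = u ≡ a ⊎ u ≡ b ⊎ u ≡ c

-- Definitionally the membership test inside addFace, so addFace-cong is a matter of cong₂.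
inTriple : ∀ {n} → Fin n → Fin n → Fin n → Fin n → Bool
inTriple a b c u = (u == a) ∨ ((u == b) ∨ (u == c))

inTriple⇒InTriple : ∀ {n} {a b c u : Fin n} → inTriple a b c u ≡ true → InTriple a b c u
inTriple⇒InTriple {a = a} {b} {c} {u} eq =
  Sum.map ==⇒≡ (Sum.map ==⇒≡ ==⇒≡ ∘ ∨≡true (u == b)) (∨≡true (u == a) eq)

inTriple-swap₁₂ : ∀ {n} (a b c u : Fin n) → inTriple b a c u ≡ inTriple a b c u
inTriple-swap₁₂ a b c u = ∨-Properties.x∙yz≈y∙xz (u == b) (u == a) (u == c)

inTriple-rotate : ∀ {n} (a b c u : Fin n) → inTriple c a b u ≡ inTriple a b c u
inTriple-rotate a b c u = ∨-Properties.x∙yz≈y∙zx (u == c) (u == a) (u == b)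

SameComplex : ∀ {n} → Raw n → Raw n → Set
SameComplex H H′ = (∀ u v → E H u v ≡ E H′ u v) × (∀ x y z → F H x y z ≡ F H′ x y z)

CopyOfM-resp : ∀ {n} {H H′ : Raw n} → SameComplex H H′ → CopyOfM H → CopyOfM H′
CopyOfM-resp {H = H} {H′} (E≡ , F≡) (a , b , c , abc , only-c , only-b , path) =
  a , b , c , trans (sym (F≡ a b c)) abc
  , (λ z abz → only-c z (trans (F≡ a b z) abz))
  , (λ z acz → only-b z (trans (F≡ a c z) acz))
  , Star.map step path
  where
  step : ∀ {u v} → AvoidStep H a b c u v → AvoidStep H′ a b c u v
  step {u} {v} (uv , not-ab , not-ac) = trans (sym (E≡ u v)) uv , not-ab , not-ac

addFace-cong : ∀ {n} (H : Raw n) {a b c a′ b′ c′ : Fin n} →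
  (∀ u → inTriple a b c u ≡ inTriple a′ b′ c′ u) → SameComplex (addFace H a b c) (addFace H a′ b′ c′)
addFace-cong H T≡T′ =
    (λ u v → cong₂ (λ s t → E H u v ∨ (s ∧ (t ∧ not (u == v)))) (T≡T′ u) (T≡T′ v))
  , (λ x y z → cong₂ (λ s t → F H x y z ∨ (s ∧ t)) (T≡T′ x)
       (cong₂ (λ s t → s ∧ (t ∧ (not (x == y) ∧ (not (y == z) ∧ not (x == z))))) (T≡T′ y) (T≡T′ z)))

module _ {n} (H : Raw n) (a b c : Fin n) where

  addFace-⊇ : ∀ {u v} → E H u v ≡ true → E (addFace H a b c) u v ≡ true
  addFace-⊇ uv rewrite uv = refl

  addFace-⊇ᶠ : ∀ {x y z} → F H x y z ≡ true → F (addFace H a b c) x y z ≡ true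
  addFace-⊇ᶠ xyz rewrite xyz = refl

  addFace-edge : ∀ {u v} → E (addFace H a b c) u v ≡ true →
    E H u v ≡ true ⊎ (InTriple a b c u × InTriple a b c v × u ≢ v)
  addFace-edge {u} {v} eq = Sum.map₂ new (∨≡true (E H u v) eq)
    where
    new : (inTriple a b c u ∧ (inTriple a b c v ∧ not (u == v))) ≡ true →
      InTriple a b c u × InTriple a b c v × u ≢ v
    new eq′ with ∧≡true (inTriple a b c u) eq′
    ... | u∈T , rest with ∧≡true (inTriple a b c v) rest
    ...   | v∈T , u≢v = inTriple⇒InTriple u∈T , inTriple⇒InTriple v∈T , not==⇒≢ u≢v

  addFace-face : ∀ {x y z} → F (addFace H a b c) x y z ≡ true →
    F H x y z ≡ true ⊎ (InTriple a b c z × x ≢ y × y ≢ z × x ≢ z)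
  addFace-face {x} {y} {z} eq = Sum.map₂ new (∨≡true (F H x y z) eq)
    where
    new : (inTriple a b c x ∧ (inTriple a b c y ∧ (inTriple a b c z ∧
            (not (x == y) ∧ (not (y == z) ∧ not (x == z)))))) ≡ true →
      InTriple a b c z × x ≢ y × y ≢ z × x ≢ z
    new eq′ with ∧≡true (inTriple a b c z) (proj₂ (∧≡true (inTriple a b c y) (proj₂ (∧≡true (inTriple a b c x) eq′))))
    ... | z∈T , rest with ∧≡true (not (x == y)) rest
    ...   | x≢y , rest′ with ∧≡true (not (y == z)) rest′
    ...     | y≢z , x≢z = inTriple⇒InTriple z∈T , not==⇒≢ x≢y , not==⇒≢ y≢z , not==⇒≢ x≢z

  addFace-triangle : a ≢ b → b ≢ c → a ≢ c → F (addFace H a b c) a b c ≡ true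
  addFace-triangle a≢b b≢c a≢c
    rewrite ==-refl a | ==-refl b | ==-refl c
          | ==-false a≢b | ==-false b≢c | ==-false a≢c
          | ==-false (a≢b ∘ sym) | ==-false (b≢c ∘ sym) | ==-false (a≢c ∘ sym) = ∨-zeroʳ (F H a b c)

  copyOfM-at : IsComplex H → a ≢ b → b ≢ c → a ≢ c → E H a b ≡ false → E H a c ≡ false →
    (∃ λ w → E H a w ≡ true × E H w b ≡ true) → CopyOfM (addFace H a b c)
  copyOfM-at isC a≢b b≢c a≢c ab∉H ac∉H (w , aw , wb) =
    a , b , c , addFace-triangle a≢b b≢c a≢c , only-c , only-b , avoiding aw ◅ avoiding wb ◅ ε
    where
    open IsComplex isC
    only-c : ∀ z → F (addFace H a b c) a b z ≡ true → z ≡ c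
    only-c z abz with addFace-face abz
    ... | inj₁ abz∈H                            = ⊥-elim (not-¬ (F-E a b z abz∈H) ab∉H)
    ... | inj₂ (inj₁ refl , _ , _ , a≢a)        = ⊥-elim (a≢a refl)
    ... | inj₂ (inj₂ (inj₁ refl) , _ , b≢b , _) = ⊥-elim (b≢b refl)
    ... | inj₂ (inj₂ (inj₂ z≡c) , _)            = z≡c
    only-b : ∀ z → F (addFace H a b c) a c z ≡ true → z ≡ b
    only-b z acz with addFace-face acz
    ... | inj₁ acz∈H                            = ⊥-elim (not-¬ (F-E a c z acz∈H) ac∉H)
    ... | inj₂ (inj₁ refl , _ , _ , a≢a)        = ⊥-elim (a≢a refl)
    ... | inj₂ (inj₂ (inj₁ z≡b) , _)            = z≡b
    ... | inj₂ (inj₂ (inj₂ refl) , _ , c≢c , _) = ⊥-elim (c≢c refl)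
    avoiding : ∀ {u v} → E H u v ≡ true → AvoidStep (addFace H a b c) a b c u v
    avoiding {u} {v} uv = addFace-⊇ uv , not-edge ab∉H , not-edge ac∉H
      where
      not-edge : ∀ {x} → E H a x ≡ false → ¬ sameEdge u v a x
      not-edge ax∉H (inj₁ (refl , refl)) = not-¬ uv ax∉H
      not-edge ax∉H (inj₂ (refl , refl)) = not-¬ (adjacent-sym isC uv) ax∉H

  induced-addFace : ∀ {φ} (g : Fin n → Bool) → (∀ u v → φ u v ≡ φ v u) →
    (∀ u v → E H u v ≡ true → φ u v ≡ (g u xor g v)) →
    φ a b ≡ (g a xor g b) → φ b c ≡ (g b xor g c) → φ a c ≡ (g a xor g c) →
    Induced (addFace H a b c) φ
  induced-addFace {φ} g φ-sym on-H ab bc ac = g , induced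
    where
    flipped : ∀ {u v} → φ u v ≡ (g u xor g v) → φ v u ≡ (g v xor g u)
    flipped {u} {v} uv = trans (φ-sym v u) (trans uv (xor-comm (g u) (g v)))
    on-T : ∀ {u v} → InTriple a b c u → InTriple a b c v → u ≢ v → φ u v ≡ (g u xor g v)
    on-T (inj₁ refl)        (inj₁ refl)        u≢u = ⊥-elim (u≢u refl)
    on-T (inj₁ refl)        (inj₂ (inj₁ refl)) _   = ab
    on-T (inj₁ refl)        (inj₂ (inj₂ refl)) _   = ac
    on-T (inj₂ (inj₁ refl)) (inj₁ refl)        _   = flipped ab
    on-T (inj₂ (inj₁ refl)) (inj₂ (inj₁ refl)) u≢u = ⊥-elim (u≢u refl)
    on-T (inj₂ (inj₁ refl)) (inj₂ (inj₂ refl)) _   = bc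
    on-T (inj₂ (inj₂ refl)) (inj₁ refl)        _   = flipped ac
    on-T (inj₂ (inj₂ refl)) (inj₂ (inj₁ refl)) _   = flipped bc
    on-T (inj₂ (inj₂ refl)) (inj₂ (inj₂ refl)) u≢u = ⊥-elim (u≢u refl)
    induced : ∀ u v → E (addFace H a b c) u v ≡ true → φ u v ≡ (g u xor g v)
    induced u v uv with addFace-edge uv
    ... | inj₁ uv∈H              = on-H u v uv∈H
    ... | inj₂ (u∈T , v∈T , u≢v) = on-T u∈T v∈T u≢v

module _ {n} {H : Raw n} (isC : IsComplex H) {a b c : Fin n} (a≢b : a ≢ b) (b≢c : b ≢ c) (a≢c : a ≢ c) where
  open IsComplex isC

  copyOfM-or-induced : (∀ u v → u ≢ v → ∃ λ w → E H u w ≡ true × E H w v ≡ true) →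
    ∀ {φ} → (∀ u v → φ u v ≡ φ v u) → EvenOnFaces (addFace H a b c) φ →
    (g : Fin n → Bool) → (∀ u v → E H u v ≡ true → φ u v ≡ (g u xor g v)) →
    CopyOfM (addFace H a b c) ⊎ Induced (addFace H a b c) φ
  copyOfM-or-induced common {φ} φ-sym φ-even g on-H = by-sides (E H a b) (E H b c) (E H a c) refl refl refl
    where
    T-even : φ a b xor (φ b c xor φ a c) ≡ false
    T-even = φ-even a b c (addFace-triangle H a b c a≢b b≢c a≢c)
    T-even-bc : φ b c xor (φ a c xor φ a b) ≡ false
    T-even-bc = even-rotate (φ a b) (φ b c) (φ a c) T-even
    T-even-ac : φ a c xor (φ a b xor φ b c) ≡ false
    T-even-ac = even-rotate (φ b c) (φ a c) (φ a b) T-even-bc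
    δ-even : (g a xor g b) xor ((g b xor g c) xor (g a xor g c)) ≡ false
    δ-even = coboundary-even (g a) (g b) (g c)
    δ-even-bc : (g b xor g c) xor ((g a xor g c) xor (g a xor g b)) ≡ false
    δ-even-bc = even-rotate (g a xor g b) (g b xor g c) (g a xor g c) δ-even
    δ-even-ac : (g a xor g c) xor ((g a xor g b) xor (g b xor g c)) ≡ false
    δ-even-ac = even-rotate (g b xor g c) (g a xor g c) (g a xor g b) δ-even-bc

    by-sides : ∀ x y z → E H a b ≡ x → E H b c ≡ y → E H a c ≡ z →
      CopyOfM (addFace H a b c) ⊎ Induced (addFace H a b c) φ
    by-sides false _ false ab _ ac = inj₁ (copyOfM-at H a b c isC a≢b b≢c a≢c ab ac (common a b a≢b))
    by-sides false false true ab bc _ = inj₁ (CopyOfM-resp (addFace-cong H (inTriple-swap₁₂ a b c))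
      (copyOfM-at H b a c isC (a≢b ∘ sym) a≢c b≢c (trans (E-sym b a) ab) bc (common b a (a≢b ∘ sym))))
    by-sides true false false _ bc ac = inj₁ (CopyOfM-resp (addFace-cong H (inTriple-rotate a b c))
      (copyOfM-at H c a b isC (a≢c ∘ sym) a≢b (b≢c ∘ sym) (trans (E-sym c a) ac) (trans (E-sym c b) bc)
                  (common c a (a≢c ∘ sym))))
    by-sides false true true _ bc ac = inj₂ (induced-addFace H a b c g φ-sym on-H
      (third-of-even T-even δ-even (on-H b c bc) (on-H a c ac)) (on-H b c bc) (on-H a c ac))
    by-sides true false true ab _ ac = inj₂ (induced-addFace H a b c g φ-sym on-H
      (on-H a b ab) (third-of-even T-even-bc δ-even-bc (on-H a c ac) (on-H a b ab)) (on-H a c ac))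
    by-sides true true false ab bc _ = inj₂ (induced-addFace H a b c g φ-sym on-H
      (on-H a b ab) (on-H b c bc) (third-of-even T-even-ac δ-even-ac (on-H a b ab) (on-H b c bc)))
    by-sides true true true ab bc ac = inj₂ (induced-addFace H a b c g φ-sym on-H
      (on-H a b ab) (on-H b c bc) (on-H a c ac))

count-witness : ∀ {n} (f : Fin n → Bool) → 1 ≤ count f → ∃ λ x → f x ≡ true
count-witness {n} f = go (allFin n)
  where
  go : ∀ xs → 1 ≤ sum (map (λ x → if f x then 1 else 0) xs) → ∃ λ x → f x ≡ true
  go []       ()
  go (x ∷ xs) pos with f x in fx
  ... | true  = x , fx
  ... | false = go xs pos

lemma5p6 : (n k : ℕ) → 1 ≤ k → (H : Raw n) → IsComplex H →
    (∀ u v → u ≢ v → k ≤ twoPaths H u v) →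
    HomologicallyConnected H →
    (a b c : Fin n) → a ≢ b → b ≢ c → a ≢ c →
    (∃ λ φ → Bad (addFace H a b c) φ × supportSize φ ≤ k) →
    CopyOfM (addFace H a b c)
lemma5p6 n k 1≤k H isC k≤twoPaths (_ , h1) a b c a≢b b≢c a≢c
         (φ , ((φ-sym , _) , φ-even , not-induced) , _) =
  Sum.[ (λ copy → copy) , ⊥-elim ∘ not-induced ]
    (copyOfM-or-induced isC a≢b b≢c a≢c common φ-sym φ-even g on-H)
  where
  common : ∀ u v → u ≢ v → ∃ λ w → E H u w ≡ true × E H w v ≡ true
  common u v u≢v = Product.map₂ (∧≡true (E H u _)) (count-witness _ (ℕ.≤-trans 1≤k (k≤twoPaths u v u≢v)))

  restriction-induced : Induced H (restrict H φ)
  restriction-induced = cocycle⇒induced isC h1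
    (restrict-isCocycle isC φ-sym (λ x y z → φ-even x y z ∘ addFace-⊇ᶠ H a b c))
    a (walks-of-diameter-two isC common a)

  g : Fin n → Bool
  g = proj₁ restriction-induced

  on-H : ∀ u v → E H u v ≡ true → φ u v ≡ (g u xor g v)
  on-H u v uv = trans (sym (restrict-on-edge isC {φ} uv)) (proj₂ restriction-induced u v uv)
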